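{- For every integer $a\ge 3$, $$ s(a,a+3,a+4,a+5)=\begin{cases} \dfrac{(a+5)(a^3+8 a^2+55 a+90)}{150}&\text{if } a\equiv 0\pmod 5,\\ \dfrac{(a+4)(a^3+9 a^2+35 a+105)}{150}&\text{if } a\equiv 1\pmod 5,\\ \dfrac{(a+3)(a^3+10 a^2+41 a+110)}{150}&\text{if } a\equiv 2\pmod 5,\\ \dfrac{(a+2)(a^3+11 a^2+43 a+105)}{150}&\text{if } a\equiv 3\pmod 5,\\ \dfrac{(a+6)(a^3+7 a^2+41 a+65)}{150}&\text{if } a\equiv 4\pmod 5. \end{cases} $$
   Context: For positive integers $a_1,\dots,a_m$ with $\gcd(a_1,\dots,a_m)=1$, the Sylvester sum $s(a_1,\dots,a_m)$ is the sum of all positive integers that cannot be written as $x_1a_1+\cdots+x_ma_m$ with nonnegative integers $x_i$. -}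

module Defs where

open import Data.Nat using (ℕ; _*_; _≤_)
open import Data.Vec using (Vec; zipWith)
open import Data.Vec using () renaming (sum to vsum)
open import Data.List using (List)
open import Data.Nat.ListAction using (sum)
open import Data.List.Membership.Propositional using (_∈_)
open import Data.List.Relation.Unary.Unique.Propositional using (Unique)
open import Data.Product using (Σ; ∃; _×_)
open import Function.Bundles using (_⇔_)
open import Relation.Nullary using (¬_)
open import Relation.Binary.PropositionalEquality using (_≡_)

Representable : ∀ {m} → Vec ℕ m → ℕ → Set
Representable {m} as n = Σ (Vec ℕ m) λ xs → n ≡ vsum (zipWith _*_ xs as)

IsSylvesterSum : ∀ {m} → Vec ℕ m → ℕ → Set
IsSylvesterSum as S =
  Σ (List ℕ) λ L →
    Unique L ×
    (∀ n → (n ∈ L) ⇔ ((1 ≤ n) × ¬ Representable as n)) ×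
    sum L ≡ S

-- A sum of k of the generators a, a + 3, a + 4, a + 5 is k·a + t with t ∈ {0} ∪ [3, 5k].
-- Writing n = q·a + r with 0 ≤ r < a, a representation of n uses at most q generators, so n is
-- representable iff r = 0, or 3 ≤ r ≤ 5q, or (one copy of a absorbed into t) a + r ≤ 5(q − 1).
-- Hence the gaps are the q·a + r with 5q < r < a, together with the two columns q·a + 1 and
-- q·a + 2 for 1 ≤ q ≤ ⌊(a + 4 + r)/5⌋. Summing these arithmetic progressions gives a polynomial
-- in a and three row counts, each of which is ⌊a/5⌋ plus a constant on a residue class of a
-- modulo 5; the five formulas are then polynomial identities in ⌊a/5⌋.

module Submission where

open import Defs
open import Data.Nat using (ℕ; _+_; _*_; _^_; _≤_; _%_)
open import Data.Vec using (Vec; _∷_; [])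
open import Data.Product using (∃; _×_)
open import Relation.Binary.PropositionalEquality using (_≡_)

open import Data.Nat using (zero; suc; _∸_; _<_; _/_; z≤n; s≤s; NonZero; >-nonZero; _<?_; _≤?_)
open import Data.Nat.Properties
open import Data.Nat.DivMod using (m*n/n≡m; m/n*n≤m; /-monoˡ-≤; +-distrib-/-∣ˡ; [m+kn]%n≡m%n; m<n⇒m%n≡m; m≡m%n+[m/n]*n; m%n<n)
open import Data.Nat.Divisibility using (divides-refl)
open import Data.Nat.Tactic.RingSolver using (solve-∀; solve)
open import Data.Nat.ListAction using (sum)
open import Data.Nat.ListAction.Properties using (sum-++)
open import Data.List using (List; []; _∷_; _++_; _∷ʳ_; applyUpTo)
open import Data.List.Properties using (applyUpTo-∷ʳ)
open import Data.List.Membership.Propositional using (_∈_; _∉_)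
open import Data.List.Membership.Propositional.Properties using (∈-applyUpTo⁺; ∈-applyUpTo⁻; ∈-++⁺ˡ; ∈-++⁺ʳ; ∈-++⁻)
open import Data.List.Relation.Unary.Unique.Propositional using (Unique)
open import Data.List.Relation.Unary.AllPairs using ([])
open import Data.List.Relation.Unary.Unique.Propositional.Properties using (++⁺; applyUpTo⁺₁)
open import Data.Product using (∃₂; _,_; proj₁; proj₂)
open import Data.Sum using (_⊎_; inj₁; inj₂)
open import Data.Empty using (⊥-elim)
open import Function.Base using (_∘_; _∋_)
open import Function.Bundles using (mk⇔)
open import Relation.Nullary using (¬_; yes; no)
open import Relation.Binary.Definitions using (tri<; tri≈; tri>)
open import Relation.Binary.PropositionalEquality using (refl; sym; trans; cong; cong₂; subst; module ≡-Reasoning)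
open import Algebra.Properties.CommutativeSemigroup +-commutativeSemigroup using (x∙yz≈y∙xz)

-- Division with remainder

m+n≡o⇒m≤o : ∀ {m n o} → m + n ≡ o → m ≤ o
m+n≡o⇒m≤o {m} {n} eq = subst (m ≤_) eq (m≤m+n m n)

m*n≤o⇒m≤o/n : ∀ m n {o} .{{_ : NonZero n}} → m * n ≤ o → m ≤ o / n
m*n≤o⇒m≤o/n m n mn≤o = subst (_≤ _) (m*n/n≡m m n) (/-monoˡ-≤ n mn≤o)

m≤o/n⇒m*n≤o : ∀ {m} n {o} .{{_ : NonZero n}} → m ≤ o / n → m * n ≤ o
m≤o/n⇒m*n≤o n {o} m≤o/n = ≤-trans (*-monoˡ-≤ n m≤o/n) (m/n*n≤m o n)

[m*n+o]/n≡m+o/n : ∀ m n o .{{_ : NonZero n}} → (m * n + o) / n ≡ m + o / n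
[m*n+o]/n≡m+o/n m n o = trans (+-distrib-/-∣ˡ o (divides-refl m)) (cong (_+ o / n) (m*n/n≡m m n))

divMod-unique : ∀ {a r r′} q q′ → r < a → r′ < a → q * a + r ≡ q′ * a + r′ → q ≡ q′ × r ≡ r′
divMod-unique {a@(suc _)} {r} {r′} q q′ r<a r′<a eq = *-cancelʳ-≡ q q′ a (+-cancelʳ-≡ r _ _ qa+r≡q′a+r) , r≡r′
  where
  open ≡-Reasoning
  r≡r′ : r ≡ r′
  r≡r′ = begin
    r                ≡⟨ m<n⇒m%n≡m r<a ⟨
    r % a            ≡⟨ [m+kn]%n≡m%n r q a ⟨
    (r + q * a) % a  ≡⟨ cong (_% a) (trans (+-comm r _) (trans eq (+-comm _ r′))) ⟩
    (r′ + q′ * a) % a ≡⟨ [m+kn]%n≡m%n r′ q′ a ⟩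
    r′ % a           ≡⟨ m<n⇒m%n≡m r′<a ⟩
    r′               ∎
  qa+r≡q′a+r : q * a + r ≡ q′ * a + r
  qa+r≡q′a+r = subst (λ x → q * a + r ≡ q′ * a + x) (sym r≡r′) eq

[1+k+d]*a+t≡k*a+[a+d*a+t] : ∀ k d a t → (suc k + d) * a + t ≡ k * a + (a + d * a + t)
[1+k+d]*a+t≡k*a+[a+d*a+t] = solve-∀

divMod-compare : ∀ {a r t} q k → r < a → q * a + r ≡ k * a + t →
                 (k ≡ q × t ≡ r) ⊎ (k < q × a + r ≤ t)
divMod-compare {a} {r} {t} q k r<a eq with <-cmp k q
... | tri≈ _ refl _ = inj₁ (refl , sym (+-cancelˡ-≡ (k * a) r t eq))
... | tri< k<q _ _ with m≤n⇒∃[o]m+o≡n k<q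
...   | d , refl = inj₂ (k<q , subst (a + r ≤_) t≡ (+-monoˡ-≤ r (m≤m+n a (d * a))))
  where
  t≡ : a + d * a + r ≡ t
  t≡ = +-cancelˡ-≡ (k * a) _ t (trans (sym ([1+k+d]*a+t≡k*a+[a+d*a+t] k d a r)) eq)
divMod-compare {a} {r} {t} q k r<a eq | tri> _ _ q<k with m≤n⇒∃[o]m+o≡n q<k
...   | d , refl = ⊥-elim (<⇒≱ r<a (subst (a ≤_) (sym r≡) (≤-trans (m≤m+n a (d * a)) (m≤m+n _ t))))
  where
  r≡ : r ≡ a + d * a + t
  r≡ = +-cancelˡ-≡ (q * a) r _ (trans eq ([1+k+d]*a+t≡k*a+[a+d*a+t] q d a t))

-- Representations by a, a + 3, a + 4, a + 5

gens : ℕ → Vec ℕ 4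
gens a = a ∷ a + 3 ∷ a + 4 ∷ a + 5 ∷ []

-- Excess k t: some sum of exactly k generators equals k · a + t.
Excess : ℕ → ℕ → Set
Excess k t = t ≡ 0 ⊎ (3 ≤ t × t ≤ k * 5)

gens-combination : ∀ a x₁ x₂ x₃ x₄ →
  x₁ * a + (x₂ * (a + 3) + (x₃ * (a + 4) + (x₄ * (a + 5) + 0))) ≡
  (x₂ + x₃ + x₄ + x₁) * a + (3 * x₂ + 4 * x₃ + 5 * x₄)
gens-combination = solve-∀

excess-decomposition : ∀ k t → 3 ≤ t → t ≤ k * 5 →
  ∃₂ λ x₂ x₃ → ∃ λ x₄ → x₂ + x₃ + x₄ ≤ k × t ≡ 3 * x₂ + 4 * x₃ + 5 * x₄
excess-decomposition zero    t 3≤t t≤0 = ⊥-elim (<⇒≱ (≤-trans (s≤s z≤n) 3≤t) t≤0)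
excess-decomposition (suc k) 1 (s≤s ()) _
excess-decomposition (suc k) 2 (s≤s (s≤s ())) _
excess-decomposition (suc k) 3 _ _ = 1 , 0 , 0 , s≤s z≤n , refl
excess-decomposition (suc k) 4 _ _ = 0 , 1 , 0 , s≤s z≤n , refl
excess-decomposition (suc k) 5 _ _ = 0 , 0 , 1 , s≤s z≤n , refl
excess-decomposition 1 6 _ (s≤s (s≤s (s≤s (s≤s (s≤s ())))))
excess-decomposition 1 7 _ (s≤s (s≤s (s≤s (s≤s (s≤s ())))))
excess-decomposition (suc (suc k)) 6 _ _ = 2 , 0 , 0 , s≤s (s≤s z≤n) , refl
excess-decomposition (suc (suc k)) 7 _ _ = 1 , 1 , 0 , s≤s (s≤s z≤n) , refl
excess-decomposition (suc k) (suc (suc (suc (suc (suc t@(suc (suc (suc _)))))))) _ t+5≤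
  with excess-decomposition k t (s≤s (s≤s (s≤s z≤n))) (+-cancelˡ-≤ 5 t (k * 5) t+5≤)
... | x₂ , x₃ , x₄ , count≤k , t≡ =
  x₂ , x₃ , suc x₄ , subst (_≤ suc k) (sym (+-suc (x₂ + x₃) x₄)) (s≤s count≤k) ,
  trans (cong (5 +_) t≡) (add-5 x₂ x₃ x₄)
  where
  add-5 : ∀ x₂ x₃ x₄ → 5 + (3 * x₂ + 4 * x₃ + 5 * x₄) ≡ 3 * x₂ + 4 * x₃ + 5 * suc x₄
  add-5 = solve-∀

excess⇒representable : ∀ a k {t} → Excess k t → Representable (gens a) (k * a + t)
excess⇒representable a k (inj₁ refl) = (k ∷ 0 ∷ 0 ∷ 0 ∷ []) , refl
excess⇒representable a k {t} (inj₂ (3≤t , t≤5k))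
  with excess-decomposition k t 3≤t t≤5k
... | x₂ , x₃ , x₄ , count≤k , refl with m≤n⇒∃[o]m+o≡n count≤k
...   | x₁ , refl = (x₁ ∷ x₂ ∷ x₃ ∷ x₄ ∷ []) , sym (gens-combination a x₁ x₂ x₃ x₄)

representable⇒excess : ∀ a {n} → Representable (gens a) n → ∃₂ λ k t → n ≡ k * a + t × Excess k t
representable⇒excess a (x₁ ∷ x₂ ∷ x₃ ∷ x₄ ∷ [] , refl) =
  x₂ + x₃ + x₄ + x₁ , 3 * x₂ + 4 * x₃ + 5 * x₄ , gens-combination a x₁ x₂ x₃ x₄ , excess x₁ x₂ x₃ x₄
  where
  lower : ∀ x₂ x₃ x₄ → 3 * (x₂ + x₃ + x₄) + (x₃ + 2 * x₄) ≡ 3 * x₂ + 4 * x₃ + 5 * x₄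
  lower = solve-∀
  upper : ∀ x₁ x₂ x₃ x₄ → 3 * x₂ + 4 * x₃ + 5 * x₄ + (2 * x₂ + x₃ + 5 * x₁) ≡ (x₂ + x₃ + x₄ + x₁) * 5
  upper = solve-∀
  excess-nonzero : ∀ x₁ x₂ x₃ x₄ → 1 ≤ x₂ + x₃ + x₄ → Excess (x₂ + x₃ + x₄ + x₁) (3 * x₂ + 4 * x₃ + 5 * x₄)
  excess-nonzero x₁ x₂ x₃ x₄ 1≤count = inj₂
    (≤-trans (*-monoʳ-≤ 3 1≤count) (m+n≡o⇒m≤o (lower x₂ x₃ x₄)) , m+n≡o⇒m≤o (upper x₁ x₂ x₃ x₄))
  excess : ∀ x₁ x₂ x₃ x₄ → Excess (x₂ + x₃ + x₄ + x₁) (3 * x₂ + 4 * x₃ + 5 * x₄)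
  excess x₁ 0 0 0 = inj₁ refl
  excess x₁ x₂@(suc _) x₃ x₄ = excess-nonzero x₁ x₂ x₃ x₄ (s≤s z≤n)
  excess x₁ 0 x₃@(suc _) x₄ = excess-nonzero x₁ 0 x₃ x₄ (s≤s z≤n)
  excess x₁ 0 0 x₄@(suc _) = excess-nonzero x₁ 0 0 x₄ (s≤s z≤n)

excess⇒≤*5 : ∀ {k t} → Excess k t → t ≤ k * 5
excess⇒≤*5 (inj₁ refl) = z≤n
excess⇒≤*5 (inj₂ (_ , t≤5k)) = t≤5k

-- A representation of q · a + r uses either exactly q generators, or fewer, and then its
-- excess contains at least one whole copy of a.
representable⇒excess-at-division : ∀ {a r} q → r < a → Representable (gens a) (q * a + r) →
  Excess q r ⊎ ∃ λ k → k < q × a + r ≤ k * 5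
representable⇒excess-at-division {a} {r} q r<a rep with representable⇒excess a rep
... | k , t , eq , excess with divMod-compare q k r<a eq
...   | inj₁ (refl , refl) = inj₁ excess
...   | inj₂ (k<q , a+r≤t) = inj₂ (k , k<q , ≤-trans a+r≤t (excess⇒≤*5 {k} excess))

lowGap-nonrepresentable : ∀ {a r} q → q * 5 < r → r < a → ¬ Representable (gens a) (q * a + r)
lowGap-nonrepresentable {a} {r} q 5q<r r<a rep with representable⇒excess-at-division q r<a rep
... | inj₁ (inj₁ refl) = n≮0 5q<r
... | inj₁ (inj₂ (_ , r≤5q)) = <⇒≱ 5q<r r≤5q
... | inj₂ (k , k<q , a+r≤5k) =
  <⇒≱ 5q<r (≤-trans (m≤n+m r a) (≤-trans a+r≤5k (*-monoˡ-≤ 5 (<⇒≤ k<q))))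

columnGap-nonrepresentable : ∀ {a r} q → 0 < r → r ≤ 2 → q * 5 ≤ a + (4 + r) → r < a →
                             ¬ Representable (gens a) (q * a + r)
columnGap-nonrepresentable {a} {r} q 0<r r≤2 5q≤a+4+r r<a rep
  with representable⇒excess-at-division q r<a rep
... | inj₁ (inj₁ refl) = n≮0 0<r
... | inj₁ (inj₂ (3≤r , _)) = <⇒≱ (s≤s r≤2) 3≤r
... | inj₂ (k , k<q , a+r≤5k) = <⇒≱ (n<1+n (4 + k * 5)) (begin
  5 + k * 5      ≤⟨ *-monoˡ-≤ 5 k<q ⟩
  q * 5          ≤⟨ 5q≤a+4+r ⟩
  a + (4 + r)    ≡⟨ x∙yz≈y∙xz a 4 r ⟩
  4 + (a + r)    ≤⟨ +-monoʳ-≤ 4 a+r≤5k ⟩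
  4 + k * 5      ∎)
  where open ≤-Reasoning

-- The gaps

block : ℕ → ℕ → List ℕ
block a q = applyUpTo (q * a + suc (q * 5) +_) (a ∸ suc (q * 5))

lowGaps : ℕ → ℕ → List ℕ
lowGaps a zero    = []
lowGaps a (suc q) = lowGaps a q ++ block a q

column : ℕ → ℕ → ℕ → List ℕ
column a r h = applyUpTo (λ i → suc i * a + r) h

∈-block⁻ : ∀ a q {x} → x ∈ block a q → ∃ λ r → q * 5 < r × r < a × x ≡ q * a + r
∈-block⁻ a q x∈ with ∈-applyUpTo⁻ (q * a + suc (q * 5) +_) x∈
... | i , i<ℓ , refl = suc (q * 5) + i , s≤s (m≤m+n (q * 5) i) , r<a , +-assoc (q * a) _ i
  where
  5q+1<a : suc (q * 5) < a
  5q+1<a = m∸n≢0⇒n<m (λ ℓ≡0 → n≮0 (subst (i <_) ℓ≡0 i<ℓ))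
  r<a : suc (q * 5) + i < a
  r<a = subst (suc (q * 5) + i <_) (m+[n∸m]≡n (<⇒≤ 5q+1<a)) (+-monoʳ-< (suc (q * 5)) i<ℓ)

∈-block⁺ : ∀ a q {r} → q * 5 < r → r < a → q * a + r ∈ block a q
∈-block⁺ a q {r} 5q<r r<a =
  subst (_∈ block a q) element≡ (∈-applyUpTo⁺ (q * a + suc (q * 5) +_) (∸-monoˡ-< r<a 5q<r))
  where
  element≡ : q * a + suc (q * 5) + (r ∸ suc (q * 5)) ≡ q * a + r
  element≡ = trans (+-assoc (q * a) _ _) (cong (q * a +_) (m+[n∸m]≡n 5q<r))

∈-lowGaps⁻ : ∀ a Q {x} → x ∈ lowGaps a Q → ∃₂ λ q r → q < Q × q * 5 < r × r < a × x ≡ q * a + r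
∈-lowGaps⁻ a (suc Q) x∈ with ∈-++⁻ (lowGaps a Q) x∈
... | inj₁ x∈lowGaps with ∈-lowGaps⁻ a Q x∈lowGaps
...   | q , r , q<Q , rest = q , r , m<n⇒m<1+n q<Q , rest
∈-lowGaps⁻ a (suc Q) x∈ | inj₂ x∈block with ∈-block⁻ a Q x∈block
...   | r , rest = Q , r , n<1+n Q , rest

∈-lowGaps⁺ : ∀ a Q q {r} → q < Q → q * 5 < r → r < a → q * a + r ∈ lowGaps a Q
∈-lowGaps⁺ a (suc Q) q q<1+Q 5q<r r<a with m<1+n⇒m<n∨m≡n q<1+Q
... | inj₁ q<Q = ∈-++⁺ˡ (∈-lowGaps⁺ a Q q q<Q 5q<r r<a)
... | inj₂ refl = ∈-++⁺ʳ (lowGaps a Q) (∈-block⁺ a q 5q<r r<a)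

∈-column⁻ : ∀ a r h {x} → x ∈ column a r h → ∃ λ q → 0 < q × q ≤ h × x ≡ q * a + r
∈-column⁻ a r h x∈ with ∈-applyUpTo⁻ (λ i → suc i * a + r) x∈
... | i , i<h , x≡ = suc i , s≤s z≤n , i<h , x≡

∈-column⁺ : ∀ a r h {q} → 0 < q → q ≤ h → q * a + r ∈ column a r h
∈-column⁺ a r h {suc i} _ q≤h = ∈-applyUpTo⁺ (λ i → suc i * a + r) q≤h

block-unique : ∀ a q → Unique (block a q)
block-unique a q = applyUpTo⁺₁ _ _ (λ i<j _ eq → <⇒≢ i<j (+-cancelˡ-≡ (q * a + suc (q * 5)) _ _ eq))

lowGaps-unique : ∀ a Q → Unique (lowGaps a Q)
lowGaps-unique a zero    = []
lowGaps-unique a (suc Q) = ++⁺ (lowGaps-unique a Q) (block-unique a Q) disjoint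
  where
  disjoint : ∀ {x} → ¬ (x ∈ lowGaps a Q × x ∈ block a Q)
  disjoint (x∈lowGaps , x∈block) with ∈-lowGaps⁻ a Q x∈lowGaps | ∈-block⁻ a Q x∈block
  ... | q , r , q<Q , _ , r<a , refl | r′ , _ , r′<a , eq =
    <⇒≢ q<Q (proj₁ (divMod-unique q Q r<a r′<a eq))

column-unique : ∀ {a r} h → r < a → Unique (column a r h)
column-unique h r<a = applyUpTo⁺₁ _ h (λ i<j _ eq → <⇒≢ (s≤s i<j) (proj₁ (divMod-unique _ _ r<a r<a eq)))

-- lowRows a counts the q with 5q + 1 < a; columnHeight a r is the largest q with 5q ≤ a + 4 + r.
lowRows : ℕ → ℕ
lowRows a = (a + 3) / 5

columnHeight : ℕ → ℕ → ℕ
columnHeight a r = (a + (4 + r)) / 5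

gaps : ℕ → List ℕ
gaps a = lowGaps a (lowRows a) ++ column a 1 (columnHeight a 1) ++ column a 2 (columnHeight a 2)

lowGaps-column-disjoint : ∀ a Q {r} h {x} → r ≤ 2 → r < a → x ∈ lowGaps a Q → x ∉ column a r h
lowGaps-column-disjoint a Q {r} h r≤2 r<a x∈lowGaps x∈column
  with ∈-lowGaps⁻ a Q x∈lowGaps | ∈-column⁻ a r h x∈column
... | q , r′ , _ , 5q<r′ , r′<a , refl | q′ , 0<q′ , _ , eq with divMod-unique q q′ r′<a r<a eq
...   | refl , refl = <⇒≱ 5q<r′ (≤-trans (≤-trans r≤2 (s≤s (s≤s z≤n))) (*-monoˡ-≤ 5 0<q′))

gaps-unique : ∀ {a} → 3 ≤ a → Unique (gaps a)
gaps-unique {a} 3≤a = ++⁺ (lowGaps-unique a (lowRows a))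
  (++⁺ (column-unique _ 1<a) (column-unique _ 3≤a) columns-disjoint) low-disjoint
  where
  1<a : 1 < a
  1<a = ≤-trans (s≤s (s≤s z≤n)) 3≤a
  columns-disjoint : ∀ {x} → ¬ (x ∈ column a 1 (columnHeight a 1) × x ∈ column a 2 (columnHeight a 2))
  columns-disjoint (x∈₁ , x∈₂)
    with ∈-column⁻ a 1 (columnHeight a 1) x∈₁ | ∈-column⁻ a 2 (columnHeight a 2) x∈₂
  ... | q , _ , _ , refl | q′ , _ , _ , eq with divMod-unique q q′ 1<a 3≤a eq
  ...   | _ , ()
  low-disjoint : ∀ {x} → ¬ (x ∈ lowGaps a (lowRows a) ×
                            x ∈ (column a 1 (columnHeight a 1) ++ column a 2 (columnHeight a 2)))
  low-disjoint (x∈low , x∈columns) with ∈-++⁻ (column a 1 (columnHeight a 1)) x∈columns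
  ... | inj₁ x∈₁ = lowGaps-column-disjoint a (lowRows a) (columnHeight a 1) (s≤s z≤n) 1<a x∈low x∈₁
  ... | inj₂ x∈₂ = lowGaps-column-disjoint a (lowRows a) (columnHeight a 2) (s≤s (s≤s z≤n)) 3≤a x∈low x∈₂

lowGap⇒nonrepresentable : ∀ a Q {x} → x ∈ lowGaps a Q → 0 < x × ¬ Representable (gens a) x
lowGap⇒nonrepresentable a Q x∈ with ∈-lowGaps⁻ a Q x∈
... | q , r , _ , 5q<r , r<a , refl =
  ≤-trans (s≤s z≤n) (≤-trans 5q<r (m≤n+m r (q * a))) , lowGap-nonrepresentable q 5q<r r<a

columnGap⇒nonrepresentable : ∀ {a r x} → 0 < r → r ≤ 2 → r < a → x ∈ column a r (columnHeight a r) →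
                             0 < x × ¬ Representable (gens a) x
columnGap⇒nonrepresentable {a} {r} 0<r r≤2 r<a x∈ with ∈-column⁻ a r (columnHeight a r) x∈
... | q , _ , q≤h , refl =
  ≤-trans 0<r (m≤n+m r (q * a)) , columnGap-nonrepresentable q 0<r r≤2 (m≤o/n⇒m*n≤o 5 q≤h) r<a

gap⇒nonrepresentable : ∀ {a x} → 3 ≤ a → x ∈ gaps a → 0 < x × ¬ Representable (gens a) x
gap⇒nonrepresentable {a} 3≤a x∈gaps with ∈-++⁻ (lowGaps a (lowRows a)) x∈gaps
... | inj₁ x∈low = lowGap⇒nonrepresentable a (lowRows a) x∈low
... | inj₂ x∈columns with ∈-++⁻ (column a 1 (columnHeight a 1)) x∈columns
...   | inj₁ x∈₁ = columnGap⇒nonrepresentable (s≤s z≤n) (s≤s z≤n) (≤-trans (s≤s (s≤s z≤n)) 3≤a) x∈₁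
...   | inj₂ x∈₂ = columnGap⇒nonrepresentable (s≤s z≤n) ≤-refl 3≤a x∈₂

nonrepresentable⇒columnGap : ∀ {a} q {r} → 3 ≤ a → 0 < r → r ≤ q * 5 →
  ¬ Representable (gens a) (q * a + r) → q * a + r ∈ column a r (columnHeight a r)
nonrepresentable⇒columnGap zero 3≤a 0<r r≤0 _ = ⊥-elim (<⇒≱ 0<r r≤0)
nonrepresentable⇒columnGap {a} (suc k) {r} 3≤a 0<r _ ¬rep with a + r ≤? k * 5
... | yes a+r≤5k = ⊥-elim (¬rep (subst (Representable (gens a))
    (trans (x∙yz≈y∙xz (k * a) a r) (sym (+-assoc a (k * a) r)))
    (excess⇒representable a k (inj₂ (≤-trans 3≤a (m≤m+n a r) , a+r≤5k)))))
... | no a+r≰5k = ∈-column⁺ a r (columnHeight a r) (s≤s z≤n) (m*n≤o⇒m≤o/n (suc k) 5 (begin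
  5 + k * 5      ≡⟨⟩
  4 + suc (k * 5) ≤⟨ +-monoʳ-≤ 4 (≰⇒> a+r≰5k) ⟩
  4 + (a + r)    ≡⟨ x∙yz≈y∙xz a 4 r ⟨
  a + (4 + r)    ∎))
  where open ≤-Reasoning

nonrepresentable⇒gap : ∀ {a} q {r} → 3 ≤ a → r < a →
  ¬ Representable (gens a) (q * a + r) → q * a + r ∈ gaps a
nonrepresentable⇒gap {a} q {r} 3≤a r<a ¬rep with q * 5 <? r
... | yes 5q<r = ∈-++⁺ˡ (∈-lowGaps⁺ a (lowRows a) q q<rows 5q<r r<a)
  where
  q<rows : q < lowRows a
  q<rows = m*n≤o⇒m≤o/n (suc q) 5
    (subst (5 + q * 5 ≤_) (+-comm 3 a) (+-monoʳ-≤ 3 (≤-trans (s≤s 5q<r) r<a)))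
... | no 5q≮r = smallRemainder r (≮⇒≥ 5q≮r) ¬rep
  where
  smallRemainder : ∀ r → r ≤ q * 5 → ¬ Representable (gens a) (q * a + r) → q * a + r ∈ gaps a
  smallRemainder 0 _ ¬rep = ⊥-elim (¬rep (excess⇒representable a q (inj₁ refl)))
  smallRemainder 1 r≤5q ¬rep =
    ∈-++⁺ʳ (lowGaps a (lowRows a)) (∈-++⁺ˡ (nonrepresentable⇒columnGap q 3≤a (s≤s z≤n) r≤5q ¬rep))
  smallRemainder 2 r≤5q ¬rep =
    ∈-++⁺ʳ (lowGaps a (lowRows a)) (∈-++⁺ʳ (column a 1 (columnHeight a 1))
      (nonrepresentable⇒columnGap q 3≤a (s≤s z≤n) r≤5q ¬rep))
  smallRemainder r@(suc (suc (suc _))) r≤5q ¬rep =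
    ⊥-elim (¬rep (excess⇒representable a q (inj₂ (s≤s (s≤s (s≤s z≤n)) , r≤5q))))

sylvesterSum-gaps : ∀ {a} → 3 ≤ a → IsSylvesterSum (gens a) (sum (gaps a))
sylvesterSum-gaps {a} 3≤a =
  gaps a , gaps-unique 3≤a , (λ n → mk⇔ (gap⇒nonrepresentable 3≤a) (complete n ∘ proj₂)) , refl
  where
  instance
    a≢0 : NonZero a
    a≢0 = >-nonZero (≤-trans (s≤s z≤n) 3≤a)
  complete : ∀ n → ¬ Representable (gens a) n → n ∈ gaps a
  complete n ¬rep = subst (_∈ gaps a) (sym n≡)
    (nonrepresentable⇒gap (n / a) 3≤a (m%n<n n a) (¬rep ∘ subst (Representable (gens a)) (sym n≡)))
    where
    n≡ : n ≡ n / a * a + n % a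
    n≡ = trans (m≡m%n+[m/n]*n n a) (+-comm (n % a) _)

-- The sum of the gaps

sum-applyUpTo-suc : ∀ (f : ℕ → ℕ) n → sum (applyUpTo f (suc n)) ≡ sum (applyUpTo f n) + f n
sum-applyUpTo-suc f n = begin
  sum (applyUpTo f (suc n))         ≡⟨ cong sum (applyUpTo-∷ʳ f n) ⟨
  sum (applyUpTo f n ∷ʳ f n)        ≡⟨ sum-++ (applyUpTo f n) (f n ∷ []) ⟩
  sum (applyUpTo f n) + (f n + 0)   ≡⟨ cong (sum (applyUpTo f n) +_) (+-identityʳ (f n)) ⟩
  sum (applyUpTo f n) + f n         ∎
  where open ≡-Reasoning

sum-applyUpTo-+ : ∀ c n → 2 * sum (applyUpTo (c +_) n) + n ≡ n * (2 * c + n)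
sum-applyUpTo-+ c zero    = refl
sum-applyUpTo-+ c (suc n) = begin
  2 * sum (applyUpTo (c +_) (suc n)) + suc n  ≡⟨ cong (λ s → 2 * s + suc n) (sum-applyUpTo-suc (c +_) n) ⟩
  2 * (S + (c + n)) + suc n                   ≡⟨ regroup S c n ⟩
  (2 * S + n) + (2 * c + 2 * n + 1)           ≡⟨ cong (_+ (2 * c + 2 * n + 1)) (sum-applyUpTo-+ c n) ⟩
  n * (2 * c + n) + (2 * c + 2 * n + 1)       ≡⟨ square c n ⟩
  suc n * (2 * c + suc n)                     ∎
  where
  open ≡-Reasoning
  S = sum (applyUpTo (c +_) n)
  regroup : ∀ S c n → 2 * (S + (c + n)) + suc n ≡ (2 * S + n) + (2 * c + 2 * n + 1)
  regroup = solve-∀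
  square : ∀ c n → n * (2 * c + n) + (2 * c + 2 * n + 1) ≡ suc n * (2 * c + suc n)
  square = solve-∀

sum-column : ∀ a r h → 2 * sum (column a r h) ≡ h * ((h + 1) * a + 2 * r)
sum-column a r zero    = refl
sum-column a r (suc h) = begin
  2 * sum (column a r (suc h))                ≡⟨ cong (2 *_) (sum-applyUpTo-suc (λ i → suc i * a + r) h) ⟩
  2 * (sum (column a r h) + (suc h * a + r))  ≡⟨ *-distribˡ-+ 2 (sum (column a r h)) _ ⟩
  2 * sum (column a r h) + 2 * (suc h * a + r) ≡⟨ cong (_+ 2 * (suc h * a + r)) (sum-column a r h) ⟩
  h * ((h + 1) * a + 2 * r) + 2 * (suc h * a + r) ≡⟨ extend a r h ⟩
  suc h * ((suc h + 1) * a + 2 * r)           ∎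
  where
  open ≡-Reasoning
  extend : ∀ a r h → h * ((h + 1) * a + 2 * r) + 2 * (suc h * a + r) ≡ suc h * ((suc h + 1) * a + 2 * r)
  extend = solve-∀

-- The equations below are type families so that the ring solver, which unfolds only the head
-- of its goal, can prove their instances.

-- 12 S = 6Q²(a² + 4a + 10) − 10Q(a + 1) − 10Q³(2a + 5), with the negative terms moved left.
LowGapsSum : ℕ → ℕ → ℕ → Set
LowGapsSum a Q S = 12 * S + 10 * Q * (a + 1 + Q * Q * (2 * a + 5)) ≡ 6 * Q * Q * (a * a + 4 * a + 10)

LowGapsStep : ℕ → ℕ → ℕ → Set
LowGapsStep a Q ℓ =
  6 * Q * Q * (a * a + 4 * a + 10) + 6 * (ℓ * (2 * (Q * a + suc (Q * 5)) + ℓ)) +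
    10 * suc Q * (a + 1 + suc Q * suc Q * (2 * a + 5)) ≡
  6 * suc Q * suc Q * (a * a + 4 * a + 10) + (10 * Q * (a + 1 + Q * Q * (2 * a + 5)) + 6 * ℓ)

lowGaps-identity : ∀ Q ℓ → LowGapsStep (suc (Q * 5) + ℓ) Q ℓ
lowGaps-identity Q ℓ = solve (List ℕ ∋ Q ∷ ℓ ∷ [])

lowGaps-step : ∀ a Q ℓ S B → suc (Q * 5) + ℓ ≡ a → LowGapsSum a Q S →
  2 * B + ℓ ≡ ℓ * (2 * (Q * a + suc (Q * 5)) + ℓ) → LowGapsSum a (suc Q) (S + B)
lowGaps-step a Q ℓ S B refl ih block-sum = +-cancelʳ-≡ (D Q + 6 * ℓ) _ _ (begin
  12 * (S + B) + D (suc Q) + (D Q + 6 * ℓ)      ≡⟨ regroup S B ℓ (D Q) (D (suc Q)) ⟩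
  (12 * S + D Q) + 6 * (2 * B + ℓ) + D (suc Q)  ≡⟨ cong₂ (λ x y → x + 6 * y + D (suc Q)) ih block-sum ⟩
  E Q + 6 * (ℓ * (2 * (Q * a + suc (Q * 5)) + ℓ)) + D (suc Q) ≡⟨ lowGaps-identity Q ℓ ⟩
  E (suc Q) + (D Q + 6 * ℓ)                     ∎)
  where
  open ≡-Reasoning
  D E : ℕ → ℕ
  D q = 10 * q * (a + 1 + q * q * (2 * a + 5))
  E q = 6 * q * q * (a * a + 4 * a + 10)
  regroup : ∀ S B ℓ x y → 12 * (S + B) + y + (x + 6 * ℓ) ≡ (12 * S + x) + 6 * (2 * B + ℓ) + y
  regroup = solve-∀

sum-lowGaps : ∀ a Q → Q * 5 ≤ a + 4 → LowGapsSum a Q (sum (lowGaps a Q))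
sum-lowGaps a zero    _ = refl
sum-lowGaps a (suc Q) 5Q+5≤a+4 rewrite sum-++ (lowGaps a Q) (block a Q) =
  lowGaps-step a Q (a ∸ suc (Q * 5)) (sum (lowGaps a Q)) (sum (block a Q)) (m+[n∸m]≡n 5Q<a)
    (sum-lowGaps a Q (≤-trans (m≤n+m (Q * 5) 5) 5Q+5≤a+4))
    (sum-applyUpTo-+ (Q * a + suc (Q * 5)) (a ∸ suc (Q * 5)))
  where
  5Q<a : suc (Q * 5) ≤ a
  5Q<a = +-cancelʳ-≤ 4 _ _ (subst (_≤ a + 4) (+-comm 4 (suc (Q * 5))) 5Q+5≤a+4)

GapSum : ℕ → ℕ → ℕ → ℕ → ℕ → Set
GapSum a Q Q₁ Q₂ S = 12 * S + 10 * Q * (a + 1 + Q * Q * (2 * a + 5)) ≡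
  6 * Q * Q * (a * a + 4 * a + 10) + 6 * (Q₁ * ((Q₁ + 1) * a + 2)) + 6 * (Q₂ * ((Q₂ + 1) * a + 4))

sum-gaps : ∀ a {Q Q₁ Q₂} → lowRows a ≡ Q → columnHeight a 1 ≡ Q₁ → columnHeight a 2 ≡ Q₂ →
           GapSum a Q Q₁ Q₂ (sum (gaps a))
sum-gaps a refl refl refl = begin
  12 * sum (gaps a) + D                       ≡⟨ cong (λ s → 12 * s + D) sum≡ ⟩
  12 * (S + (S₁ + S₂)) + D                    ≡⟨ regroup S S₁ S₂ D ⟩
  (12 * S + D) + 6 * (2 * S₁) + 6 * (2 * S₂)  ≡⟨ cong₂ (λ x y → x + 6 * y + 6 * (2 * S₂))
                                                   (sum-lowGaps a Q rows≤) (sum-column a 1 Q₁) ⟩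
  E + 6 * C₁ + 6 * (2 * S₂)                   ≡⟨ cong (λ y → E + 6 * C₁ + 6 * y) (sum-column a 2 Q₂) ⟩
  E + 6 * C₁ + 6 * (Q₂ * ((Q₂ + 1) * a + 4))  ∎
  where
  open ≡-Reasoning
  Q = lowRows a
  Q₁ = columnHeight a 1
  Q₂ = columnHeight a 2
  S = sum (lowGaps a Q)
  S₁ = sum (column a 1 Q₁)
  S₂ = sum (column a 2 Q₂)
  D = 10 * Q * (a + 1 + Q * Q * (2 * a + 5))
  E = 6 * Q * Q * (a * a + 4 * a + 10)
  C₁ = Q₁ * ((Q₁ + 1) * a + 2)
  sum≡ : sum (gaps a) ≡ S + (S₁ + S₂)
  sum≡ = trans (sum-++ (lowGaps a Q) _) (cong (S +_) (sum-++ (column a 1 Q₁) _))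
  rows≤ : Q * 5 ≤ a + 4
  rows≤ = ≤-trans (m≤o/n⇒m*n≤o 5 ≤-refl) (+-monoʳ-≤ a (n≤1+n 3))
  regroup : ∀ S S₁ S₂ D → 12 * (S + (S₁ + S₂)) + D ≡ (12 * S + D) + 6 * (2 * S₁) + 6 * (2 * S₂)
  regroup = solve-∀

-- 150 · GapSum, with 150 S replaced by the claimed value (a + α)(a³ + βa² + γa + δ).
ClosedForm : (a Q Q₁ Q₂ α β γ δ : ℕ) → Set
ClosedForm a Q Q₁ Q₂ α β γ δ =
  12 * ((a + α) * (a * (a * a) + β * (a * a) + γ * a + δ)) +
    150 * (10 * Q * (a + 1 + Q * Q * (2 * a + 5))) ≡
  150 * (6 * Q * Q * (a * a + 4 * a + 10) + 6 * (Q₁ * ((Q₁ + 1) * a + 2)) + 6 * (Q₂ * ((Q₂ + 1) * a + 4)))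

powers-unfold : ∀ a α β γ δ →
  (a + α) * (a * (a * a) + β * (a * a) + γ * a + δ) ≡ (a + α) * (a ^ 3 + β * a ^ 2 + γ * a + δ)
powers-unfold a α β γ δ = sym (cong₂ (λ x y → (a + α) * (x + β * y + γ * a + δ))
  (cong (λ x → a * (a * x)) (*-identityʳ a)) (cong (a *_) (*-identityʳ a)))

sum-gaps-residue : ∀ c α β γ δ →
  (∀ m → ClosedForm (m * 5 + c) (m + (c + 3) / 5) (m + (c + 5) / 5) (m + (c + 6) / 5) α β γ δ) →
  ∀ m → let a = m * 5 + c in 150 * sum (gaps a) ≡ (a + α) * (a ^ 3 + β * a ^ 2 + γ * a + δ)
sum-gaps-residue c α β γ δ closedForm m = begin
  150 * S ≡⟨ *-cancelˡ-≡ _ _ 12 (+-cancelʳ-≡ (150 * D) _ _ twelve-times) ⟩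
  P       ≡⟨ powers-unfold a α β γ δ ⟩
  (a + α) * (a ^ 3 + β * a ^ 2 + γ * a + δ) ∎
  where
  open ≡-Reasoning
  a = m * 5 + c
  Q = m + (c + 3) / 5
  Q₁ = m + (c + 5) / 5
  Q₂ = m + (c + 6) / 5
  S = sum (gaps a)
  D = 10 * Q * (a + 1 + Q * Q * (2 * a + 5))
  F = 6 * Q * Q * (a * a + 4 * a + 10) + 6 * (Q₁ * ((Q₁ + 1) * a + 2)) +
      6 * (Q₂ * ((Q₂ + 1) * a + 4))
  P = (a + α) * (a * (a * a) + β * (a * a) + γ * a + δ)
  quotient : ∀ j → (a + j) / 5 ≡ m + (c + j) / 5
  quotient j = trans (cong (_/ 5) (+-assoc (m * 5) c j)) ([m*n+o]/n≡m+o/n m 5 (c + j))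
  distribute : ∀ S D → 12 * (150 * S) + 150 * D ≡ 150 * (12 * S + D)
  distribute = solve-∀
  twelve-times : 12 * (150 * S) + 150 * D ≡ 12 * P + 150 * D
  twelve-times = begin
    12 * (150 * S) + 150 * D  ≡⟨ distribute S D ⟩
    150 * (12 * S + D)        ≡⟨ cong (150 *_) (sum-gaps a (quotient 3) (quotient 5) (quotient 6)) ⟩
    150 * F                   ≡⟨ closedForm m ⟨
    12 * P + 150 * D          ∎

sylvesterSum-residue : ∀ c α β γ δ →
  (∀ m → ClosedForm (m * 5 + c) (m + (c + 3) / 5) (m + (c + 5) / 5) (m + (c + 6) / 5) α β γ δ) →
  ∀ a → 3 ≤ a → a % 5 ≡ c →
  ∃ λ s → IsSylvesterSum (gens a) s × 150 * s ≡ (a + α) * (a ^ 3 + β * a ^ 2 + γ * a + δ)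
sylvesterSum-residue c α β γ δ closedForm a 3≤a a%5≡c =
  sum (gaps a) , sylvesterSum-gaps 3≤a ,
  subst (λ x → 150 * sum (gaps x) ≡ (x + α) * (x ^ 3 + β * x ^ 2 + γ * x + δ)) (sym a≡)
    (sum-gaps-residue c α β γ δ closedForm (a / 5))
  where
  a≡ : a ≡ a / 5 * 5 + c
  a≡ = trans (m≡m%n+[m/n]*n a 5) (trans (cong (_+ a / 5 * 5) a%5≡c) (+-comm c _))

closedForm-residue0 : ∀ m → ClosedForm (m * 5 + 0) (m + 0) (m + 1) (m + 1) 5 8 55 90
closedForm-residue0 m = solve (List ℕ ∋ m ∷ [])

closedForm-residue1 : ∀ m → ClosedForm (m * 5 + 1) (m + 0) (m + 1) (m + 1) 4 9 35 105
closedForm-residue1 m = solve (List ℕ ∋ m ∷ [])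

closedForm-residue2 : ∀ m → ClosedForm (m * 5 + 2) (m + 1) (m + 1) (m + 1) 3 10 41 110
closedForm-residue2 m = solve (List ℕ ∋ m ∷ [])

closedForm-residue3 : ∀ m → ClosedForm (m * 5 + 3) (m + 1) (m + 1) (m + 1) 2 11 43 105
closedForm-residue3 m = solve (List ℕ ∋ m ∷ [])

closedForm-residue4 : ∀ m → ClosedForm (m * 5 + 4) (m + 1) (m + 1) (m + 2) 6 7 41 65
closedForm-residue4 m = solve (List ℕ ∋ m ∷ [])

corollary4 : (a : ℕ) → 3 ≤ a →
    (a % 5 ≡ 0 → ∃ λ s → IsSylvesterSum (a ∷ a + 3 ∷ a + 4 ∷ a + 5 ∷ []) s ×
        150 * s ≡ (a + 5) * (a ^ 3 + 8 * a ^ 2 + 55 * a + 90)) ×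
    (a % 5 ≡ 1 → ∃ λ s → IsSylvesterSum (a ∷ a + 3 ∷ a + 4 ∷ a + 5 ∷ []) s ×
        150 * s ≡ (a + 4) * (a ^ 3 + 9 * a ^ 2 + 35 * a + 105)) ×
    (a % 5 ≡ 2 → ∃ λ s → IsSylvesterSum (a ∷ a + 3 ∷ a + 4 ∷ a + 5 ∷ []) s ×
        150 * s ≡ (a + 3) * (a ^ 3 + 10 * a ^ 2 + 41 * a + 110)) ×
    (a % 5 ≡ 3 → ∃ λ s → IsSylvesterSum (a ∷ a + 3 ∷ a + 4 ∷ a + 5 ∷ []) s ×
        150 * s ≡ (a + 2) * (a ^ 3 + 11 * a ^ 2 + 43 * a + 105)) ×
    (a % 5 ≡ 4 → ∃ λ s → IsSylvesterSum (a ∷ a + 3 ∷ a + 4 ∷ a + 5 ∷ []) s ×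
        150 * s ≡ (a + 6) * (a ^ 3 + 7 * a ^ 2 + 41 * a + 65))
corollary4 a 3≤a =
  sylvesterSum-residue 0 5 8 55 90 closedForm-residue0 a 3≤a ,
  sylvesterSum-residue 1 4 9 35 105 closedForm-residue1 a 3≤a ,
  sylvesterSum-residue 2 3 10 41 110 closedForm-residue2 a 3≤a ,
  sylvesterSum-residue 3 2 11 43 105 closedForm-residue3 a 3≤a ,
  sylvesterSum-residue 4 6 7 41 65 closedForm-residue4 a 3≤a
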